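{- For every positive integer $n$ and every positive integer $m$, $\chi_{ld}(F_n+\overline{K_m})=2n+2$.
   Context: For a graph $G=(V,E)$ of order $N$ and a bijection $f\colon V\to\{1,\dots,N\}$, the weight of a vertex $u$ is $w(u)=\sum_{x\in N(u)}f(x)$, where $N(u)$ is the open neighborhood of $u$. The bijection $f$ is a local distance antimagic labeling if $w(u)\neq w(v)$ for every edge $uv$. $\chi_{ld}(G)$ is the minimum number of distinct weights over all local distance antimagic labelings of $G$. The friendship graph $F_n$ has vertex set $\{c\}\cup\{u_i,v_i:1\le i\le n\}$ and edges $cu_i, cv_i, u_iv_i$ for $1\le i\le n$ (i.e. $n$ copies of $K_2$ joined to a central vertex $c$). $\overline{K_m}$ is the edgeless graph on $m$ vertices, and $G+H$ is the join of $G$ and $H$ (disjoint union plus all edges between $V(G)$ and $V(H)$). -}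

module Defs where

open import Data.Nat using (ℕ; zero; suc; _+_; _≤_; _≟_)
open import Data.Bool using (Bool; true; false; if_then_else_; T)
open import Data.Fin using (Fin; toℕ) renaming (_≟_ to _≟ᶠ_)
open import Data.Nat.ListAction using (sum)
open import Relation.Nullary.Decidable using (⌊_⌋)
open import Data.List using (List; []; _∷_; map; length; deduplicate; _++_; allFin)
open import Data.Product using (Σ; _×_; ∃-syntax)
open import Function.Bundles using (_⤖_; Bijection)
open import Relation.Binary.PropositionalEquality using (_≡_; _≢_)

-- Generic notions for a finite graph given by
--   * a vertex type V together with an enumeration `vs` listing each
--     vertex exactly once,
--   * its order N,
--   * a (symmetric, irreflexive) Boolean adjacency relation `adj`.

-- A labeling is a bijection f : V → {1,…,N}; we represent it as a
-- bijection β : V ⤖ Fin N and set f(x) = 1 + toℕ (β x).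
Labeling : (V : Set) (N : ℕ) → Set
Labeling V N = V ⤖ Fin N

label : {V : Set} {N : ℕ} → Labeling V N → V → ℕ
label β x = suc (toℕ (Bijection.to β x))

weight : {V : Set} {N : ℕ} → List V → (V → V → Bool) → Labeling V N → V → ℕ
weight vs adj β x = sum (map (λ y → if adj x y then label β y else 0) vs)

IsLDAL : {V : Set} {N : ℕ} → List V → (V → V → Bool) → Labeling V N → Set
IsLDAL vs adj β = ∀ x y → T (adj x y) → weight vs adj β x ≢ weight vs adj β y

numWeights : {V : Set} {N : ℕ} → List V → (V → V → Bool) → Labeling V N → ℕ
numWeights vs adj β = length (deduplicate _≟_ (map (weight vs adj β) vs))

ChiLdIs : (V : Set) (N : ℕ) → List V → (V → V → Bool) → ℕ → Set
ChiLdIs V N vs adj k =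
  (Σ (Labeling V N) λ β → IsLDAL vs adj β × numWeights vs adj β ≡ k)
  × (∀ (β : Labeling V N) → IsLDAL vs adj β → k ≤ numWeights vs adj β)

data FKVertex (n m : ℕ) : Set where
  c : FKVertex n m              -- centre of F_n
  u : Fin n → FKVertex n m
  v : Fin n → FKVertex n m
  k : Fin m → FKVertex n m      -- vertices of \overline{K_m}

allFK : (n m : ℕ) → List (FKVertex n m)
allFK n m = c ∷ (map u (allFin n) ++ map v (allFin n) ++ map k (allFin m))

orderFK : ℕ → ℕ → ℕ
orderFK n m = suc (n + n + m)

eqFin : {n : ℕ} → Fin n → Fin n → Bool
eqFin i j = ⌊ i ≟ᶠ j ⌋

adjFK : {n m : ℕ} → FKVertex n m → FKVertex n m → Bool
adjFK c     (u _) = true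
adjFK c     (v _) = true
adjFK (u _) c     = true
adjFK (v _) c     = true
adjFK (u i) (v j) = eqFin i j
adjFK (v i) (u j) = eqFin i j
adjFK c     (k _) = true
adjFK (u _) (k _) = true
adjFK (v _) (k _) = true
adjFK (k _) c     = true
adjFK (k _) (u _) = true
adjFK (k _) (v _) = true
adjFK _     _     = false

-- With ΣU, ΣV, ΣK the label sums over the u_i, the v_i and the vertices of \overline{K_m}, the weights are
--   w(c) = ΣU + ΣV + ΣK,  w(u_i) = f(c) + f(v_i) + ΣK,  w(v_i) = f(c) + f(u_i) + ΣK,  w(k_j) = f(c) + ΣU + ΣV.
-- All k_j share one weight and injectivity of f separates the 2n weights of the rim; since c and the k_j
-- are adjacent to all other vertices, every local distance antimagic labeling has exactly 2n + 2 weights.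
-- One exists: if f(c) = 1 then w(c) differs from the weights of its neighbours automatically
-- (ΣU + ΣV ≥ f(u_i) + f(v_i) > f(c) + f(v_i), and ΣK ≠ 1), so only f(x) + ΣK ≠ ΣU + ΣV remains.
-- Labelling c, \overline{K_m}, the u_i, the v_i by consecutive integers gives ΣK + N < ΣU + ΣV (N the largest
-- label) when m ≤ n; labelling c, the u_i, the v_i, \overline{K_m} gives ΣU + ΣV < ΣK when n < m
-- (Gauss's formula in both cases).

module Submission where

open import Defs
open import Data.Nat using (ℕ; zero; suc; _+_; _*_; _≤_; _<_; _≥_; _≤?_; z≤n; s≤s; z<s)
open import Data.Nat.Properties
open import Data.Nat.ListAction using (sum)
open import Data.Nat.ListAction.Properties using (sum-++)
open import Data.Nat.Tactic.RingSolver using (solve-∀)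
open import Data.Bool using (if_then_else_)
open import Data.Fin using (Fin; toℕ; _↑ˡ_; _↑ʳ_; cast) renaming (zero to fzero; suc to fsuc)
open import Data.Fin.Properties using (toℕ<n; toℕ-injective; toℕ-↑ˡ; toℕ-↑ʳ; toℕ-cast; cast-involutive; +↔⊎)
  renaming (_≟_ to _≟ᶠ_)
open import Data.List using (List; _∷_; map; length; _++_; allFin; tabulate; deduplicate)
open import Data.List.Properties using (map-++; map-∘; map-tabulate; tabulate-cong; length-++; length-tabulate)
open import Data.List.Membership.Propositional using (_∈_)
open import Data.List.Membership.Propositional.Properties
  using (∈-map⁺; ∈-map⁻; ∈-++⁺ˡ; ∈-++⁺ʳ; ∈-++⁻; ∈-tabulate⁺; ∈-tabulate⁻; ∈-allFin; deduplicate-∈⇔)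
open import Data.List.Membership.Propositional.Properties.WithK using (unique∧set⇒bag)
open import Data.List.Relation.Binary.BagAndSetEquality using (∼bag⇒↭)
open import Data.List.Relation.Binary.Permutation.Propositional.Properties using (↭-length)
open import Data.List.Relation.Unary.Any using (here; there)
import Data.List.Relation.Unary.All.Properties as All
open import Data.List.Relation.Unary.All using (_∷_)
open import Data.List.Relation.Unary.AllPairs using (_∷_)
open import Data.List.Relation.Unary.Unique.Propositional using (Unique)
import Data.List.Relation.Unary.Unique.Propositional.Properties as Unique
open import Data.List.Relation.Unary.Unique.DecPropositional.Properties using (deduplicate-!)
open import Data.Product using (Σ; ∃; _×_; _,_)
open import Data.Sum using (_⊎_; inj₁; inj₂)
open import Data.Sum.Algebra using (⊎-comm)
open import Data.Sum.Function.Propositional using (_⊎-↔_)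
open import Data.Unit using (tt)
open import Data.Empty using (⊥)
open import Function using (_∘_; id; _⇔_; mk⇔)
open import Function.Bundles using (_↔_; mk↔ₛ′; Bijection)
import Function.Properties.Equivalence as ⇔
open import Function.Properties.Inverse using (↔-refl; ↔-sym; ↔-trans; ↔⇒⤖)
open import Relation.Binary.PropositionalEquality
open import Relation.Nullary.Decidable using (yes; no)

∑ : ∀ {p} → (Fin p → ℕ) → ℕ
∑ h = sum (tabulate h)

∑-cong : ∀ {p} {g h : Fin p → ℕ} → (∀ i → g i ≡ h i) → ∑ g ≡ ∑ h
∑-cong eq = cong sum (tabulate-cong eq)

∑-zero : ∀ p → ∑ {p} (λ _ → 0) ≡ 0
∑-zero zero    = refl
∑-zero (suc p) = ∑-zero p

eqFin-suc : ∀ {p} (i j : Fin p) → eqFin (fsuc i) (fsuc j) ≡ eqFin i j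
eqFin-suc i j with i ≟ᶠ j
... | yes _ = refl
... | no _  = refl

∑-δ : ∀ {p} (i : Fin p) (h : Fin p → ℕ) → ∑ (λ j → if eqFin i j then h j else 0) ≡ h i
∑-δ {suc p} fzero    h = trans (cong (h fzero +_) (∑-zero p)) (+-identityʳ _)
∑-δ {suc p} (fsuc i) h =
  trans (∑-cong (λ j → cong (λ b → if b then h (fsuc j) else 0) (eqFin-suc i j))) (∑-δ i (h ∘ fsuc))

term≤∑ : ∀ {p} (h : Fin p → ℕ) i → h i ≤ ∑ h
term≤∑ h fzero    = m≤m+n _ _
term≤∑ h (fsuc i) = ≤-trans (term≤∑ (h ∘ fsuc) i) (m≤n+m _ _)

∑≢1 : ∀ {p} (h : Fin p → ℕ) → (∀ i → 2 ≤ h i) → ∑ h ≢ 1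
∑≢1 {zero}  h _   ()
∑≢1 {suc p} h h≥2 eq = <-irrefl (sym eq) (≤-trans (h≥2 fzero) (term≤∑ h fzero))

consecutiveSum : ℕ → ℕ → ℕ
consecutiveSum a p = ∑ {p} (λ i → a + toℕ i)

consecutiveSum-suc : ∀ a p → consecutiveSum a (suc p) ≡ a + consecutiveSum (suc a) p
consecutiveSum-suc a p = cong₂ _+_ (+-identityʳ a) (∑-cong {p} (λ i → +-suc a (toℕ i)))

double-consecutiveSum : ∀ a p → 2 * consecutiveSum a p + p ≡ p * (2 * a + p)
double-consecutiveSum a zero    = refl
double-consecutiveSum a (suc p) = begin
  2 * consecutiveSum a (suc p) + suc p    ≡⟨ cong (λ s → 2 * s + suc p) (consecutiveSum-suc a p) ⟩
  2 * (a + S) + suc p                     ≡⟨ regroup a S p ⟩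
  (2 * S + p) + suc (2 * a)               ≡⟨ cong (_+ suc (2 * a)) (double-consecutiveSum (suc a) p) ⟩
  p * (2 * suc a + p) + suc (2 * a)       ≡⟨ expand a p ⟩
  suc p * (2 * a + suc p)                 ∎
  where
  open ≡-Reasoning
  S = consecutiveSum (suc a) p
  regroup : ∀ a S p → 2 * (a + S) + suc p ≡ (2 * S + p) + suc (2 * a)
  regroup = solve-∀
  expand : ∀ a p → p * (2 * suc a + p) + suc (2 * a) ≡ suc p * (2 * a + suc p)
  expand = solve-∀

double-consecutiveSum-pair : ∀ a b p →
  2 * (consecutiveSum a p + consecutiveSum b p) + (p + p) ≡ p * (2 * a + p) + p * (2 * b + p)
double-consecutiveSum-pair a b p = begin
  2 * (A + B) + (p + p)      ≡⟨ regroup A B p ⟩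
  (2 * A + p) + (2 * B + p)  ≡⟨ cong₂ _+_ (double-consecutiveSum a p) (double-consecutiveSum b p) ⟩
  p * (2 * a + p) + p * (2 * b + p) ∎
  where
  open ≡-Reasoning
  A = consecutiveSum a p
  B = consecutiveSum b p
  regroup : ∀ A B p → 2 * (A + B) + (p + p) ≡ (2 * A + p) + (2 * B + p)
  regroup = solve-∀

<-by-doubling : ∀ {x y d e P Q} → 2 * x + d ≡ P → 2 * y + e ≡ Q → P + e < Q + d → x < y
<-by-doubling {x} {y} {d} {e} refl refl lt =
  *-cancelˡ-< 2 x y (+-cancelʳ-< (d + e) (2 * x) (2 * y) (subst₂ _<_ (+-assoc (2 * x) d e) rhs lt))
  where
  rhs : 2 * y + e + d ≡ 2 * y + (d + e)
  rhs = trans (+-assoc (2 * y) e d) (cong (2 * y +_) (+-comm e d))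

<-by-slack : ∀ {P Q} s → P + suc s ≡ Q → P < Q
<-by-slack {P} s refl = m<m+n P z<s

small-independent-set-gap : ∀ {m n} → 1 ≤ m → m ≤ n →
  consecutiveSum 2 m + suc (n + n + m) < consecutiveSum (2 + m) n + consecutiveSum (2 + m + n) n
small-independent-set-gap {suc a} (s≤s z≤n) m≤n with e , refl ← m≤n⇒∃[o]m+o≡n m≤n =
  <-by-doubling (doubled-left (suc a) _) (double-consecutiveSum-pair (3 + a) (3 + a + (suc a + e)) (suc a + e))
    (<-by-slack (7 * a * a + 11 * a + 12 * a * e + 14 * e + 4 * e * e + 1) (expand a e))
  where
  regroup : ∀ K N m → 2 * (K + N) + m ≡ (2 * K + m) + 2 * N
  regroup = solve-∀
  doubled-left : ∀ m N → 2 * (consecutiveSum 2 m + N) + m ≡ m * (2 * 2 + m) + 2 * N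
  doubled-left m N = trans (regroup (consecutiveSum 2 m) N m) (cong (_+ 2 * N) (double-consecutiveSum 2 m))
  -- The slack is the difference of the two sides, expanded in a and e.
  expand : ∀ a e → let m = suc a ; n = suc a + e in
    m * (2 * 2 + m) + 2 * suc (n + n + m) + (n + n) + suc (7 * a * a + 11 * a + 12 * a * e + 14 * e + 4 * e * e + 1)
      ≡ n * (2 * (2 + m) + n) + n * (2 * (2 + m + n) + n) + m
  expand = solve-∀

large-independent-set-gap : ∀ {m n} → n < m →
  consecutiveSum 2 n + consecutiveSum (2 + n) n < consecutiveSum (2 + (n + n)) m
large-independent-set-gap {n = n} n<m with e , refl ← m≤n⇒∃[o]m+o≡n n<m =
  <-by-doubling (double-consecutiveSum-pair 2 (2 + n) n) (double-consecutiveSum (2 + (n + n)) (suc n + e))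
    (<-by-slack (n * n + 3 * n + 6 * n * e + 5 * e + e * e + 3) (expand n e))
  where
  expand : ∀ n e → let m = suc n + e in
    n * (2 * 2 + n) + n * (2 * (2 + n) + n) + m + suc (n * n + 3 * n + 6 * n * e + 5 * e + e * e + 3)
      ≡ m * (2 * (2 + (n + n)) + m) + (n + n)
  expand = solve-∀

length-deduplicate : ∀ {xs ys : List ℕ} → Unique ys → (∀ {z} → z ∈ xs ⇔ z ∈ ys) →
  length (deduplicate _≟_ xs) ≡ length ys
length-deduplicate {xs} uniq same =
  ↭-length (∼bag⇒↭ (unique∧set⇒bag (deduplicate-! _≟_ xs) uniq (⇔.trans (⇔.sym (deduplicate-∈⇔ _≟_)) same)))

∈-allFK : ∀ {n m} (x : FKVertex n m) → x ∈ allFK n m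
∈-allFK c     = here refl
∈-allFK (u i) = there (∈-++⁺ˡ (∈-map⁺ u (∈-allFin i)))
∈-allFK (v i) = there (∈-++⁺ʳ (map u (allFin _)) (∈-++⁺ˡ (∈-map⁺ v (∈-allFin i))))
∈-allFK (k j) = there (∈-++⁺ʳ (map u (allFin _)) (∈-++⁺ʳ (map v (allFin _)) (∈-map⁺ k (∈-allFin j))))

sum-map-allFK : ∀ {n m} (g : FKVertex n m → ℕ) →
  sum (map g (allFK n m)) ≡ g c + (∑ (g ∘ u) + (∑ (g ∘ v) + ∑ (g ∘ k)))
sum-map-allFK {n} {m} g = cong (g c +_) (begin
  sum (map g (us ++ vs ++ ks))                       ≡⟨ cong sum (map-++ g us (vs ++ ks)) ⟩
  sum (map g us ++ map g (vs ++ ks))                 ≡⟨ sum-++ (map g us) _ ⟩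
  sum (map g us) + sum (map g (vs ++ ks))            ≡⟨ cong (sum (map g us) +_) (cong sum (map-++ g vs ks)) ⟩
  sum (map g us) + sum (map g vs ++ map g ks)        ≡⟨ cong (sum (map g us) +_) (sum-++ (map g vs) _) ⟩
  sum (map g us) + (sum (map g vs) + sum (map g ks)) ≡⟨ cong₂ _+_ (block u) (cong₂ _+_ (block v) (block k)) ⟩
  ∑ (g ∘ u) + (∑ (g ∘ v) + ∑ (g ∘ k))                ∎)
  where
  open ≡-Reasoning
  us = map u (allFin n)
  vs = map v (allFin n)
  ks = map k (allFin m)
  block : ∀ {p} (b : Fin p → FKVertex n m) → sum (map g (map b (allFin p))) ≡ ∑ (g ∘ b)
  block b = cong sum (trans (sym (map-∘ (allFin _))) (map-tabulate id (g ∘ b)))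

module Weights {n m N : ℕ} (β : Labeling (FKVertex n m) N) where

  f : FKVertex n m → ℕ
  f = label β

  w : FKVertex n m → ℕ
  w = weight (allFK n m) adjFK β

  neighbourLabel : FKVertex n m → FKVertex n m → ℕ
  neighbourLabel x y = if adjFK x y then f y else 0

  ΣU ΣV ΣK : ℕ
  ΣU = ∑ (f ∘ u)
  ΣV = ∑ (f ∘ v)
  ΣK = ∑ (f ∘ k)

  label-injective : ∀ {x y} → f x ≡ f y → x ≡ y
  label-injective eq = Bijection.injective β (toℕ-injective (suc-injective eq))

  weight-c : w c ≡ ΣU + (ΣV + ΣK)
  weight-c = sum-map-allFK (neighbourLabel c)

  weight-u : ∀ i → w (u i) ≡ f c + (f (v i) + ΣK)
  weight-u i = trans (sum-map-allFK (neighbourLabel (u i)))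
    (cong (f c +_) (cong₂ _+_ (∑-zero n) (cong (_+ ΣK) (∑-δ i (f ∘ v)))))

  weight-v : ∀ i → w (v i) ≡ f c + (f (u i) + ΣK)
  weight-v i = trans (sum-map-allFK (neighbourLabel (v i)))
    (cong (f c +_) (cong₂ _+_ (∑-δ i (f ∘ u)) (cong (_+ ΣK) (∑-zero n))))

  weight-k : ∀ j → w (k j) ≡ f c + (ΣU + ΣV)
  weight-k j = trans (sum-map-allFK (neighbourLabel (k j)))
    (cong (λ s → f c + (ΣU + s)) (trans (cong (ΣV +_) (∑-zero m)) (+-identityʳ ΣV)))

  rim-weight-cancel : ∀ {a b} → f c + (a + ΣK) ≡ f c + (b + ΣK) → a ≡ b
  rim-weight-cancel {a} {b} eq = +-cancelʳ-≡ ΣK a b (+-cancelˡ-≡ (f c) _ _ eq)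

  centre-weight-cancel : ∀ {b} → ΣU + (ΣV + ΣK) ≡ f c + (b + ΣK) → ΣU + ΣV ≡ f c + b
  centre-weight-cancel {b} eq =
    +-cancelʳ-≡ ΣK _ _ (trans (+-assoc ΣU ΣV ΣK) (trans eq (sym (+-assoc (f c) b ΣK))))

  u-weight-injective : ∀ {i j} → w (u i) ≡ w (u j) → i ≡ j
  u-weight-injective {i} {j} eq
    with refl ← label-injective (rim-weight-cancel (trans (sym (weight-u i)) (trans eq (weight-u j)))) = refl

  v-weight-injective : ∀ {i j} → w (v i) ≡ w (v j) → i ≡ j
  v-weight-injective {i} {j} eq
    with refl ← label-injective (rim-weight-cancel (trans (sym (weight-v i)) (trans eq (weight-v j)))) = refl

  u≁v : ∀ i j → w (u i) ≢ w (v j)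
  u≁v i j eq with label-injective (rim-weight-cancel (trans (sym (weight-u i)) (trans eq (weight-v j))))
  ... | ()

  rim-pair≤ : ∀ i → f (u i) + f (v i) ≤ ΣU + ΣV
  rim-pair≤ i = +-mono-≤ (term≤∑ (f ∘ u) i) (term≤∑ (f ∘ v) i)

  rimWeights : List ℕ
  rimWeights = tabulate (w ∘ u) ++ tabulate (w ∘ v)

  ∈-rimWeights⁻ : ∀ {z} → z ∈ rimWeights → (∃ λ i → z ≡ w (u i)) ⊎ (∃ λ i → z ≡ w (v i))
  ∈-rimWeights⁻ z∈ with ∈-++⁻ (tabulate (w ∘ u)) z∈
  ... | inj₁ z∈U = inj₁ (∈-tabulate⁻ z∈U)
  ... | inj₂ z∈V = inj₂ (∈-tabulate⁻ z∈V)

  rimWeights-unique : Unique rimWeights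
  rimWeights-unique = Unique.++⁺ (Unique.tabulate⁺ u-weight-injective) (Unique.tabulate⁺ v-weight-injective) disjoint
    where
    disjoint : ∀ {z} → z ∈ tabulate (w ∘ u) × z ∈ tabulate (w ∘ v) → ⊥
    disjoint (z∈U , z∈V) with ∈-tabulate⁻ z∈U | ∈-tabulate⁻ z∈V
    ... | i , refl | j , eq = u≁v i j eq

  isLDAL⇒numWeights≡2n+2 : Fin m → IsLDAL (allFK n m) adjFK β → numWeights (allFK n m) adjFK β ≡ 2 * n + 2
  isLDAL⇒numWeights≡2n+2 j₀ ldal = trans (length-deduplicate unique same-members) length-classWeights
    where
    classWeights : List ℕ
    classWeights = w c ∷ w (k j₀) ∷ rimWeights

    unique : Unique classWeights
    unique = (ldal c (k j₀) tt ∷ All.++⁺ (All.tabulate⁺ λ i → ldal c (u i) tt) (All.tabulate⁺ λ i → ldal c (v i) tt))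
           ∷ All.++⁺ (All.tabulate⁺ λ i → ldal (k j₀) (u i) tt) (All.tabulate⁺ λ i → ldal (k j₀) (v i) tt)
           ∷ rimWeights-unique

    class : ∀ x → w x ∈ classWeights
    class c     = here refl
    class (k j) = there (here (trans (weight-k j) (sym (weight-k j₀))))
    class (u i) = there (there (∈-++⁺ˡ (∈-tabulate⁺ i)))
    class (v i) = there (there (∈-++⁺ʳ (tabulate (w ∘ u)) (∈-tabulate⁺ i)))

    realised : ∀ {z} → z ∈ classWeights → ∃ λ x → z ≡ w x
    realised (here eq)         = c , eq
    realised (there (here eq)) = k j₀ , eq
    realised (there (there z∈)) with ∈-rimWeights⁻ z∈
    ... | inj₁ (i , eq) = u i , eq
    ... | inj₂ (i , eq) = v i , eq

    same-members : ∀ {z} → z ∈ map w (allFK n m) ⇔ z ∈ classWeights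
    same-members = mk⇔
      (λ z∈ → let x , _ , eq = ∈-map⁻ w {xs = allFK n m} z∈ in subst (_∈ classWeights) (sym eq) (class x))
      (λ z∈ → let x , eq = realised z∈ in subst (_∈ map w (allFK n m)) (sym eq) (∈-map⁺ w (∈-allFK x)))

    length-classWeights : length classWeights ≡ 2 * n + 2
    length-classWeights = begin
      2 + length rimWeights ≡⟨ cong (2 +_) (length-++ (tabulate (w ∘ u))) ⟩
      2 + (length (tabulate (w ∘ u)) + length (tabulate (w ∘ v)))
        ≡⟨ cong (2 +_) (cong₂ _+_ (length-tabulate (w ∘ u)) (length-tabulate (w ∘ v))) ⟩
      2 + (n + n)           ≡⟨ regroup n ⟩
      2 * n + 2             ∎
      where
      open ≡-Reasoning
      regroup : ∀ n → 2 + (n + n) ≡ 2 * n + 2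
      regroup = solve-∀

  off-centre-≥2 : f c ≡ 1 → ∀ x → x ≢ c → 2 ≤ f x
  off-centre-≥2 f-c≡1 x x≢c = ≤∧≢⇒< (s≤s z≤n) λ 1≡fx → x≢c (label-injective (trans (sym 1≡fx) (sym f-c≡1)))

  centre-1⇒isLDAL : f c ≡ 1 → (∀ x → f x + ΣK ≢ ΣU + ΣV) → IsLDAL (allFK n m) adjFK β
  centre-1⇒isLDAL f-c≡1 avoids = ldal
    where
    centre-plus-label-small : ∀ {x y} → x ≢ c → f x + f y ≤ ΣU + ΣV → f c + f y ≢ ΣU + ΣV
    centre-plus-label-small {x} {y} x≢c le eq = <-irrefl eq (<-≤-trans
      (subst (λ a → a + f y < f x + f y) (sym f-c≡1) (+-monoˡ-≤ (f y) (off-centre-≥2 f-c≡1 x x≢c))) le)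

    c≁u : ∀ i → w c ≢ w (u i)
    c≁u i eq = centre-plus-label-small (λ ()) (rim-pair≤ i)
      (sym (centre-weight-cancel (trans (sym weight-c) (trans eq (weight-u i)))))

    c≁v : ∀ i → w c ≢ w (v i)
    c≁v i eq = centre-plus-label-small (λ ()) (≤-trans (≤-reflexive (+-comm (f (v i)) (f (u i)))) (rim-pair≤ i))
      (sym (centre-weight-cancel (trans (sym weight-c) (trans eq (weight-v i)))))

    c≁k : ∀ j → w c ≢ w (k j)
    c≁k j eq = ∑≢1 (f ∘ k) (λ j → off-centre-≥2 f-c≡1 (k j) λ ()) (trans ΣK≡fc f-c≡1)
      where
      ΣK≡fc : ΣK ≡ f c
      ΣK≡fc = +-cancelˡ-≡ (ΣU + ΣV) ΣK (f c)
        (trans (+-assoc ΣU ΣV ΣK) (trans (sym weight-c) (trans eq (trans (weight-k j) (+-comm (f c) (ΣU + ΣV))))))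

    k≁u : ∀ j i → w (k j) ≢ w (u i)
    k≁u j i eq = avoids (v i) (sym (+-cancelˡ-≡ (f c) _ _ (trans (sym (weight-k j)) (trans eq (weight-u i)))))

    k≁v : ∀ j i → w (k j) ≢ w (v i)
    k≁v j i eq = avoids (u i) (sym (+-cancelˡ-≡ (f c) _ _ (trans (sym (weight-k j)) (trans eq (weight-v i)))))

    ldal : IsLDAL (allFK n m) adjFK β
    ldal c     c     ()
    ldal c     (u i) _   = c≁u i
    ldal c     (v i) _   = c≁v i
    ldal c     (k j) _   = c≁k j
    ldal (u i) c     _   = ≢-sym (c≁u i)
    ldal (u i) (u j) ()
    ldal (u i) (v j) _   = u≁v i j
    ldal (u i) (k j) _   = ≢-sym (k≁u j i)
    ldal (v i) c     _   = ≢-sym (c≁v i)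
    ldal (v i) (u j) _   = ≢-sym (u≁v j i)
    ldal (v i) (v j) ()
    ldal (v i) (k j) _   = ≢-sym (k≁v j i)
    ldal (k j) c     _   = ≢-sym (c≁k j)
    ldal (k j) (u i) _   = k≁u j i
    ldal (k j) (v i) _   = k≁v j i
    ldal (k j) (k i) ()

Blocks : ℕ → ℕ → Set
Blocks n m = (Fin n ⊎ Fin n) ⊎ Fin m

vertexBlocks : ∀ {n m} → FKVertex n m ↔ (Fin 1 ⊎ Blocks n m)
vertexBlocks {n} {m} = mk↔ₛ′ toBlock fromBlock toBlock∘fromBlock fromBlock∘toBlock
  where
  toBlock : FKVertex n m → Fin 1 ⊎ Blocks n m
  toBlock c     = inj₁ fzero
  toBlock (u i) = inj₂ (inj₁ (inj₁ i))
  toBlock (v i) = inj₂ (inj₁ (inj₂ i))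
  toBlock (k j) = inj₂ (inj₂ j)

  fromBlock : Fin 1 ⊎ Blocks n m → FKVertex n m
  fromBlock (inj₁ fzero)            = c
  fromBlock (inj₂ (inj₁ (inj₁ i))) = u i
  fromBlock (inj₂ (inj₁ (inj₂ i))) = v i
  fromBlock (inj₂ (inj₂ j))        = k j

  toBlock∘fromBlock : ∀ b → toBlock (fromBlock b) ≡ b
  toBlock∘fromBlock (inj₁ fzero)            = refl
  toBlock∘fromBlock (inj₂ (inj₁ (inj₁ i))) = refl
  toBlock∘fromBlock (inj₂ (inj₁ (inj₂ i))) = refl
  toBlock∘fromBlock (inj₂ (inj₂ j))        = refl

  fromBlock∘toBlock : ∀ x → fromBlock (toBlock x) ≡ x
  fromBlock∘toBlock c     = refl
  fromBlock∘toBlock (u i) = refl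
  fromBlock∘toBlock (v i) = refl
  fromBlock∘toBlock (k j) = refl

-- c gets the label 1 and the vertex in block b the label 2 + toℕ (g b).
centreFirst : ∀ {n m} → Blocks n m ↔ Fin (n + n + m) → Labeling (FKVertex n m) (orderFK n m)
centreFirst g = ↔⇒⤖ (↔-trans vertexBlocks (↔-trans (↔-refl ⊎-↔ g) (↔-sym +↔⊎)))

module RimFirst (n m : ℕ) where

  β : Labeling (FKVertex n m) (orderFK n m)
  β = centreFirst (↔-trans (↔-sym +↔⊎ ⊎-↔ ↔-refl) (↔-sym +↔⊎))

  open Weights β

  ΣU≡ : ΣU ≡ consecutiveSum 2 n
  ΣU≡ = ∑-cong {n} λ i → cong (2 +_) (trans (toℕ-↑ˡ (i ↑ˡ n) m) (toℕ-↑ˡ i n))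

  ΣV≡ : ΣV ≡ consecutiveSum (2 + n) n
  ΣV≡ = ∑-cong {n} λ i → cong (2 +_) (trans (toℕ-↑ˡ (n ↑ʳ i) m) (toℕ-↑ʳ n i))

  ΣK≡ : ΣK ≡ consecutiveSum (2 + (n + n)) m
  ΣK≡ = ∑-cong {m} λ j → cong (2 +_) (toℕ-↑ʳ (n + n) j)

  isLDAL : n < m → IsLDAL (allFK n m) adjFK β
  isLDAL n<m = centre-1⇒isLDAL refl λ x eq → <-irrefl (sym eq) (<-≤-trans rim<ΣK (m≤n+m ΣK (f x)))
    where
    rim<ΣK : ΣU + ΣV < ΣK
    rim<ΣK = subst₂ _<_ (sym (cong₂ _+_ ΣU≡ ΣV≡)) (sym ΣK≡) (large-independent-set-gap n<m)

module IndependentSetFirst (n m : ℕ) where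

  β : Labeling (FKVertex n m) (orderFK n m)
  β = centreFirst (↔-trans (⊎-comm _ _) (↔-trans (↔-refl ⊎-↔ ↔-sym +↔⊎) (↔-trans (↔-sym +↔⊎) reorder)))
    where
    reorder : Fin (m + (n + n)) ↔ Fin (n + n + m)
    reorder = mk↔ₛ′ (cast (+-comm m (n + n))) (cast (+-comm (n + n) m))
      (cast-involutive (+-comm m (n + n)) (+-comm (n + n) m)) (cast-involutive (+-comm (n + n) m) (+-comm m (n + n)))

  open Weights β

  ΣK≡ : ΣK ≡ consecutiveSum 2 m
  ΣK≡ = ∑-cong {m} λ j → cong (2 +_) (trans (toℕ-cast _ (j ↑ˡ (n + n))) (toℕ-↑ˡ j (n + n)))

  ΣU≡ : ΣU ≡ consecutiveSum (2 + m) n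
  ΣU≡ = ∑-cong {n} λ i → cong (2 +_) (trans (toℕ-cast _ (m ↑ʳ (i ↑ˡ n)))
    (trans (toℕ-↑ʳ m (i ↑ˡ n)) (cong (m +_) (toℕ-↑ˡ i n))))

  ΣV≡ : ΣV ≡ consecutiveSum (2 + m + n) n
  ΣV≡ = ∑-cong {n} λ i → cong (2 +_) (trans (toℕ-cast _ (m ↑ʳ (n ↑ʳ i)))
    (trans (toℕ-↑ʳ m (n ↑ʳ i)) (trans (cong (m +_) (toℕ-↑ʳ n i)) (sym (+-assoc m n (toℕ i))))))

  isLDAL : 1 ≤ m → m ≤ n → IsLDAL (allFK n m) adjFK β
  isLDAL 1≤m m≤n = centre-1⇒isLDAL refl λ x eq → <-irrefl eq (≤-<-trans (bound x) ΣK+N<rim)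
    where
    ΣK+N<rim : ΣK + orderFK n m < ΣU + ΣV
    ΣK+N<rim = subst₂ _<_ (cong (_+ orderFK n m) (sym ΣK≡)) (sym (cong₂ _+_ ΣU≡ ΣV≡))
      (small-independent-set-gap 1≤m m≤n)
    bound : ∀ x → f x + ΣK ≤ ΣK + orderFK n m
    bound x = ≤-trans (≤-reflexive (+-comm (f x) ΣK)) (+-monoʳ-≤ ΣK (toℕ<n (Bijection.to β x)))

∃-isLDAL : ∀ n m → 1 ≤ m → Σ (Labeling (FKVertex n m) (orderFK n m)) (IsLDAL (allFK n m) adjFK)
∃-isLDAL n m 1≤m with m ≤? n
... | yes m≤n = IndependentSetFirst.β n m , IndependentSetFirst.isLDAL n m 1≤m m≤n
... | no  m≰n = RimFirst.β n m , RimFirst.isLDAL n m (≰⇒> m≰n)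

mainTheorem3 : (n m : ℕ) → n ≥ 1 → m ≥ 1 →
    ChiLdIs (FKVertex n m) (orderFK n m) (allFK n m) adjFK (2 * n + 2)
mainTheorem3 n m@(suc _) _ 1≤m with ∃-isLDAL n m 1≤m
... | β , ldal =
  (β , ldal , Weights.isLDAL⇒numWeights≡2n+2 β fzero ldal) ,
  λ β′ ldal′ → ≤-reflexive (sym (Weights.isLDAL⇒numWeights≡2n+2 β′ fzero ldal′))
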